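{- For all closed terms $P$ and $Q$ over $\Sigma_{CP}(A)$: if $P=_{fr}Q$ then $\mathrm{CP}\vdash P=Q$.
   Context: Fix a finite non-empty set $A$ of atomic propositions. Closed terms over $\Sigma_{CP}(A)$ are built from $T$, $F$ and $a\in A$ by conditional composition $P\triangleleft Q\triangleright R$. CP consists of the axioms (CP1) $x\triangleleft T\triangleright y=x$, (CP2) $x\triangleleft F\triangleright y=y$, (CP3) $T\triangleleft x\triangleright F=x$, (CP4) $x\triangleleft(y\triangleleft z\triangleright u)\triangleright v=(x\triangleleft y\triangleright v)\triangleleft z\triangleright(x\triangleleft u\triangleright v)$, with $\vdash$ derivability in equational logic. A reactive valuation algebra (RVA) is a set $RV$ with elements $T_{RV},F_{RV}$ and for each $a\in A$ functions $y_a:RV\to\{T,F\}$ and $\partial_a:RV\to RV$ with $y_a(T_{RV})=T$, $y_a(F_{RV})=F$, $\partial_a(T_{RV})=T_{RV}$, $\partial_a(F_{RV})=F_{RV}$. For closed $P$ and $H\in RV$ define $P/H$ and $\partial_P(H)$ by: $T/H=T$, $F/H=F$, $a/H=y_a(H)$, $\partial_T(H)=\partial_F(H)=H$; $(P\triangleleft Q\triangleright R)/H=P/\partial_Q(H)$ and $\partial_{P\triangleleft Q\triangleright R}(H)=\partial_P(\partial_Q(H))$ if $Q/H=T$, and $R/\partial_Q(H)$ resp. $\partial_R(\partial_Q(H))$ if $Q/H=F$. The variety $fr$ is the class of all RVAs; $P\equiv_{fr}Q$ means $P/H=Q/H$ for all RVAs and all $H$; $=_{fr}$ is the largest congruence (w.r.t.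 conditional composition) on closed terms contained in $\equiv_{fr}$. -}

module Defs where

open import Data.Nat using (ℕ; suc)
open import Data.Fin using (Fin)
open import Data.Bool using (Bool; true; false; if_then_else_)
open import Data.Empty using (⊥; ⊥-elim)
open import Data.Product using (_×_; _,_; proj₁; Σ)
open import Relation.Binary.PropositionalEquality using (_≡_)

-- The finite non-empty set A of atoms is represented as Fin (suc n).

data Term (A : Set) (V : Set) : Set where
  var  : V → Term A V
  T F  : Term A V
  atom : A → Term A V
  _◁_▷_ : Term A V → Term A V → Term A V → Term A V

Closed : Set → Set
Closed A = Term A ⊥

subst : {A V W : Set} → (V → Term A W) → Term A V → Term A W
subst σ (var x) = σ x
subst σ T = T
subst σ F = F
subst σ (atom a) = atom a
subst σ (P ◁ Q ▷ R) = subst σ P ◁ subst σ Q ▷ subst σ R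

OTerm : Set → Set
OTerm A = Term A ℕ

embed : {A : Set} → Closed A → OTerm A
embed = subst (λ ())

module _ {A : Set} where
  x y z u v : OTerm A
  x = var 0
  y = var 1
  z = var 2
  u = var 3
  v = var 4

data CPAxiom (A : Set) : OTerm A → OTerm A → Set where
  CP1 : CPAxiom A (x ◁ T ▷ y) x
  CP2 : CPAxiom A (x ◁ F ▷ y) y
  CP3 : CPAxiom A (T ◁ x ▷ F) x
  CP4 : CPAxiom A (x ◁ (y ◁ z ▷ u) ▷ v)
                  ((x ◁ y ▷ v) ◁ z ▷ (x ◁ u ▷ v))

infix 4 CP⊢_≐_
data CP⊢_≐_ {A : Set} : OTerm A → OTerm A → Set where
  ax    : ∀ {s t} → CPAxiom A s t → CP⊢ s ≐ t
  refl  : ∀ {s} → CP⊢ s ≐ s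
  sym   : ∀ {s t} → CP⊢ s ≐ t → CP⊢ t ≐ s
  trans : ∀ {s t r} → CP⊢ s ≐ t → CP⊢ t ≐ r → CP⊢ s ≐ r
  cong  : ∀ {s s' t t' r r'} → CP⊢ s ≐ s' → CP⊢ t ≐ t' → CP⊢ r ≐ r' →
          CP⊢ (s ◁ t ▷ r) ≐ (s' ◁ t' ▷ r')
  inst  : ∀ {s t} (σ : ℕ → OTerm A) → CP⊢ s ≐ t → CP⊢ subst σ s ≐ subst σ t

record RVA (A : Set) : Set₁ where
  field
    RV   : Set
    T-RV : RV
    F-RV : RV
    y[_] : A → RV → Bool
    ∂[_] : A → RV → RV
    y-T  : ∀ a → y[ a ] T-RV ≡ true
    y-F  : ∀ a → y[ a ] F-RV ≡ false
    ∂-T  : ∀ a → ∂[ a ] T-RV ≡ T-RV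
    ∂-F  : ∀ a → ∂[ a ] F-RV ≡ F-RV

-- eval P H = (P / H , ∂_P(H)).
module _ {A : Set} (𝕍 : RVA A) where
  open RVA 𝕍
  eval : Closed A → RV → Bool × RV
  eval (var ())
  eval T H = true , H
  eval F H = false , H
  eval (atom a) H = y[ a ] H , ∂[ a ] H
  eval (P ◁ Q ▷ R) H with eval Q H
  ... | true  , H' = eval P H'
  ... | false , H' = eval R H'

  _/_ : Closed A → RV → Bool
  P / H = proj₁ (eval P H)

_≡fr_ : {A : Set} → Closed A → Closed A → Set₁
_≡fr_ {A} P Q = (𝕍 : RVA A) (H : RVA.RV 𝕍) → _/_ 𝕍 P H ≡ _/_ 𝕍 Q H

record IsCongruence {A : Set} (R : Closed A → Closed A → Set₁) : Set₁ where
  field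
    reflexive  : ∀ {P} → R P P
    symmetric  : ∀ {P Q} → R P Q → R Q P
    transitive : ∀ {P Q S} → R P Q → R Q S → R P S
    compatible : ∀ {P P' Q Q' S S'} → R P P' → R Q Q' → R S S' →
                 R (P ◁ Q ▷ S) (P' ◁ Q' ▷ S')

-- P =fr Q: (P,Q) lies in the largest congruence contained in ≡fr,
-- i.e. in some congruence contained in ≡fr.
_=fr_ : {A : Set} → Closed A → Closed A → Set₂
_=fr_ {A} P Q = Σ (Closed A → Closed A → Set₁) λ R →
  IsCongruence R × (∀ {P' Q'} → R P' Q' → P' ≡fr Q') × R P Q

-- Every closed term is CP-equal to a basic form: T, F, or X ◁ a ▷ Y with X, Y basic.
-- Two different basic forms are told apart by some reactive valuation in which the
-- reply to an atom may depend on the whole history of atoms evaluated before it;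
-- the observation used is the pair (X / H , (c ◁ X ▷ c) / H), where the second
-- component reads the state left behind by X. Both components are invariant under
-- any congruence contained in ≡fr, and by soundness of CP they are the same for P
-- and its basic form; so P =fr Q forces P and Q to have the same basic form.
module Submission where

open import Defs
open import Data.Nat using (ℕ; suc; zero)
open import Data.Fin using (Fin)
import Data.Fin.Properties as Fin
open import Data.Bool using (Bool; true; false; if_then_else_)
open import Data.Maybe using (Maybe; just; nothing; maybe′)
open import Data.List using (List; []; _∷_; _++_; [_]; length)
open import Data.List.Properties using (++-assoc; ++-identityʳ)
open import Data.Product using (∃; ∃₂; _×_; _,_; proj₁; proj₂)
open import Data.Sum using (_⊎_; inj₁; inj₂)
open import Data.Empty using (⊥-elim)
open import Function using (_∘_)
open import Relation.Nullary using (¬_; does; yes; no)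
open import Relation.Nullary.Decidable using (dec-true; dec-false)
open import Relation.Binary.Definitions using (DecidableEquality)
import Relation.Binary.PropositionalEquality as ≡
open ≡ using (_≡_; _≢_; _≗_)
open ≡.≡-Reasoning

true≢false : true ≢ false
true≢false ()

subst-subst : ∀ {A V W U : Set} (ρ : W → Term A U) (σ : V → Term A W) t →
              subst ρ (subst σ t) ≡ subst (subst ρ ∘ σ) t
subst-subst ρ σ (var _) = ≡.refl
subst-subst ρ σ T = ≡.refl
subst-subst ρ σ F = ≡.refl
subst-subst ρ σ (atom _) = ≡.refl
subst-subst ρ σ (P ◁ Q ▷ R)
  rewrite subst-subst ρ σ P | subst-subst ρ σ Q | subst-subst ρ σ R = ≡.refl

subst-embed : ∀ {A} (ρ : ℕ → Closed A) P → subst ρ (embed P) ≡ P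
subst-embed ρ (var ())
subst-embed ρ T = ≡.refl
subst-embed ρ F = ≡.refl
subst-embed ρ (atom _) = ≡.refl
subst-embed ρ (P ◁ Q ▷ R)
  rewrite subst-embed ρ P | subst-embed ρ Q | subst-embed ρ R = ≡.refl

probe : ∀ {A} → A → Closed A → Closed A
probe c X = atom c ◁ X ▷ atom c

module Evaluation {A : Set} (𝕍 : RVA A) where
  open RVA 𝕍

  branch : Closed A → Closed A → Bool × RV → Bool × RV
  branch P R (true , H) = eval 𝕍 P H
  branch P R (false , H) = eval 𝕍 R H

  eval-◁▷ : ∀ P Q R H → eval 𝕍 (P ◁ Q ▷ R) H ≡ branch P R (eval 𝕍 Q H)
  eval-◁▷ P Q R H with eval 𝕍 Q H
  ... | true , _ = ≡.refl
  ... | false , _ = ≡.refl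

  branch-if : ∀ P R b H → branch P R (b , H) ≡ eval 𝕍 (if b then P else R) H
  branch-if P R true H = ≡.refl
  branch-if P R false H = ≡.refl

  eval-cong : ∀ {P P' Q Q' R R'} → eval 𝕍 P ≗ eval 𝕍 P' → eval 𝕍 Q ≗ eval 𝕍 Q' →
              eval 𝕍 R ≗ eval 𝕍 R' → eval 𝕍 (P ◁ Q ▷ R) ≗ eval 𝕍 (P' ◁ Q' ▷ R')
  eval-cong {P} {P'} {Q} {Q'} {R} {R'} p q r H = begin
    eval 𝕍 (P ◁ Q ▷ R) H        ≡⟨ eval-◁▷ P Q R H ⟩
    branch P R (eval 𝕍 Q H)     ≡⟨ ≡.cong (branch P R) (q H) ⟩
    branch P R (eval 𝕍 Q' H)    ≡⟨ branch-cong (eval 𝕍 Q' H) ⟩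
    branch P' R' (eval 𝕍 Q' H)  ≡⟨ eval-◁▷ P' Q' R' H ⟨
    eval 𝕍 (P' ◁ Q' ▷ R') H     ∎
    where
    branch-cong : ∀ w → branch P R w ≡ branch P' R' w
    branch-cong (true , H') = p H'
    branch-cong (false , H') = r H'

  CPAxiom-sound : ∀ {s t} → CPAxiom A s t → (ρ : ℕ → Closed A) →
                  eval 𝕍 (subst ρ s) ≗ eval 𝕍 (subst ρ t)
  CPAxiom-sound CP1 ρ H = ≡.refl
  CPAxiom-sound CP2 ρ H = ≡.refl
  CPAxiom-sound CP3 ρ H with eval 𝕍 (ρ 0) H
  ... | true , _ = ≡.refl
  ... | false , _ = ≡.refl
  CPAxiom-sound CP4 ρ H with eval 𝕍 (ρ 2) H
  ... | true , _ = ≡.refl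
  ... | false , _ = ≡.refl

  CP-sound-subst : ∀ {s t} → CP⊢ s ≐ t → (ρ : ℕ → Closed A) →
                   eval 𝕍 (subst ρ s) ≗ eval 𝕍 (subst ρ t)
  CP-sound-subst (ax a) ρ = CPAxiom-sound a ρ
  CP-sound-subst refl ρ H = ≡.refl
  CP-sound-subst (sym d) ρ H = ≡.sym (CP-sound-subst d ρ H)
  CP-sound-subst (trans d e) ρ H = ≡.trans (CP-sound-subst d ρ H) (CP-sound-subst e ρ H)
  CP-sound-subst (cong {P} {P'} {Q} {Q'} {R} {R'} d e f) ρ =
    eval-cong {subst ρ P} {subst ρ P'} {subst ρ Q} {subst ρ Q'} {subst ρ R} {subst ρ R'}
              (CP-sound-subst d ρ) (CP-sound-subst e ρ) (CP-sound-subst f ρ)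
  CP-sound-subst (inst {s} {t} σ d) ρ H
    rewrite subst-subst ρ σ s | subst-subst ρ σ t = CP-sound-subst d (subst ρ ∘ σ) H

  CP-sound : ∀ P Q → CP⊢ embed P ≐ embed Q → eval 𝕍 P ≗ eval 𝕍 Q
  CP-sound P Q d H =
    ≡.subst₂ (λ X Y → eval 𝕍 X H ≡ eval 𝕍 Y H) (subst-embed ρ P) (subst-embed ρ Q)
             (CP-sound-subst d ρ H)
    where
    ρ : ℕ → Closed A
    ρ _ = T

  observe : A → Closed A → RV → Bool × Bool
  observe c X H = (_/_ 𝕍 X H , _/_ 𝕍 (probe c X) H)

  readout : A → Bool × RV → Bool × Bool
  readout c (b , H) = (b , y[ c ] H)

  observe-eval : ∀ c X H → observe c X H ≡ readout c (eval 𝕍 X H)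
  observe-eval c X H with eval 𝕍 X H
  ... | true , _ = ≡.refl
  ... | false , _ = ≡.refl

  eval≡⇒observe≡ : ∀ c X H Y H' → eval 𝕍 X H ≡ eval 𝕍 Y H' → observe c X H ≡ observe c Y H'
  eval≡⇒observe≡ c X H Y H' e = begin
    observe c X H               ≡⟨ observe-eval c X H ⟩
    readout c (eval 𝕍 X H)      ≡⟨ ≡.cong (readout c) e ⟩
    readout c (eval 𝕍 Y H')     ≡⟨ observe-eval c Y H' ⟨
    observe c Y H'              ∎

open Evaluation

=fr⇒observe≡ : ∀ {A} {P Q : Closed A} → P =fr Q →
               ∀ 𝕍 c H → observe 𝕍 c P H ≡ observe 𝕍 c Q H
=fr⇒observe≡ (R , isCongruence , R⊆≡fr , RPQ) 𝕍 c H =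
  ≡.cong₂ _,_ (R⊆≡fr RPQ 𝕍 H) (R⊆≡fr (compatible reflexive RPQ reflexive) 𝕍 H)
  where open IsCongruence isCongruence

module BasicForms {A : Set} where

  data IsBasic : Closed A → Set where
    leafT : IsBasic T
    leafF : IsBasic F
    node  : ∀ {X Y} a → IsBasic X → IsBasic Y → IsBasic (X ◁ atom a ▷ Y)

  graft : Closed A → Closed A → Closed A → Closed A
  graft X (var ()) Y
  graft X T Y = X
  graft X F Y = Y
  graft X (atom a) Y = X ◁ atom a ▷ Y
  graft X (B ◁ Q ▷ B') Y = graft X B Y ◁ Q ▷ graft X B' Y

  basic : Closed A → Closed A
  basic (var ())
  basic T = T
  basic F = F
  basic (atom a) = T ◁ atom a ▷ F
  basic (P ◁ Q ▷ R) = graft (basic P) (basic Q) (basic R)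

  graft-isBasic : ∀ {X B Y} → IsBasic X → IsBasic B → IsBasic Y → IsBasic (graft X B Y)
  graft-isBasic x leafT y = x
  graft-isBasic x leafF y = y
  graft-isBasic x (node a b b') y = node a (graft-isBasic x b y) (graft-isBasic x b' y)

  basic-isBasic : ∀ P → IsBasic (basic P)
  basic-isBasic (var ())
  basic-isBasic T = leafT
  basic-isBasic F = leafF
  basic-isBasic (atom a) = node a leafT leafF
  basic-isBasic (P ◁ Q ▷ R) = graft-isBasic (basic-isBasic P) (basic-isBasic Q) (basic-isBasic R)

  args : List (OTerm A) → ℕ → OTerm A
  args [] _ = T
  args (t ∷ _) zero = t
  args (_ ∷ ts) (suc k) = args ts k

  CP⊢graft : ∀ X {B} Y → IsBasic B → CP⊢ embed (X ◁ B ▷ Y) ≐ embed (graft X B Y)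
  CP⊢graft X Y leafT = inst (args (embed X ∷ embed Y ∷ [])) (ax CP1)
  CP⊢graft X Y leafF = inst (args (embed X ∷ embed Y ∷ [])) (ax CP2)
  CP⊢graft X Y (node {B} {B'} a b b') =
    trans (inst (args (embed X ∷ embed B ∷ atom a ∷ embed B' ∷ embed Y ∷ [])) (ax CP4))
          (cong (CP⊢graft X Y b) refl (CP⊢graft X Y b'))

  CP⊢basic : ∀ P → CP⊢ embed P ≐ embed (basic P)
  CP⊢basic (var ())
  CP⊢basic T = refl
  CP⊢basic F = refl
  CP⊢basic (atom a) = sym (inst (args (atom a ∷ [])) (ax CP3))
  CP⊢basic (P ◁ Q ▷ R) =
    trans (cong (CP⊢basic P) (CP⊢basic Q) (CP⊢basic R))
          (CP⊢graft (basic P) (basic R) (basic-isBasic Q))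

  basic≡⇒CP⊢ : ∀ P Q → basic P ≡ basic Q → CP⊢ embed P ≐ embed Q
  basic≡⇒CP⊢ P Q same =
    trans (CP⊢basic P) (≡.subst (λ B → CP⊢ embed B ≐ embed Q) (≡.sym same) (sym (CP⊢basic Q)))

  observe-basic : ∀ 𝕍 c P H → observe 𝕍 c (basic P) H ≡ observe 𝕍 c P H
  observe-basic 𝕍 c P H =
    eval≡⇒observe≡ 𝕍 c (basic P) H P H (CP-sound 𝕍 (basic P) P (sym (CP⊢basic P)) H)

open BasicForms

module History {A : Set} (_≟_ : DecidableEquality A) where

  data State : Set where
    T-state F-state : State
    after : List A → State

  Oracle : Set
  Oracle = List A → A → Bool

  ℋ : Oracle → RVA A
  ℋ s = record
    { RV = State ; T-RV = T-state ; F-RV = F-state ; y[_] = reply ; ∂[_] = record-query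
    ; y-T = λ _ → ≡.refl ; y-F = λ _ → ≡.refl ; ∂-T = λ _ → ≡.refl ; ∂-F = λ _ → ≡.refl }
    where
    reply : A → State → Bool
    reply a T-state = true
    reply a F-state = false
    reply a (after l) = s l a

    record-query : A → State → State
    record-query a T-state = T-state
    record-query a F-state = F-state
    record-query a (after l) = after (l ++ [ a ])

  eval-appends : ∀ s X l → ∃₂ λ b r → eval (ℋ s) X (after l) ≡ (b , after (l ++ r))
  branch-appends : ∀ s P R b l → ∃₂ λ b' r → branch (ℋ s) P R (b , after l) ≡ (b' , after (l ++ r))

  eval-appends s (var ())
  eval-appends s T l = true , [] , ≡.cong (λ m → true , after m) (≡.sym (++-identityʳ l))
  eval-appends s F l = false , [] , ≡.cong (λ m → false , after m) (≡.sym (++-identityʳ l))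
  eval-appends s (atom a) l = s l a , [ a ] , ≡.refl
  eval-appends s (P ◁ Q ▷ R) l with eval-appends s Q l
  ... | b , r , e with branch-appends s P R b (l ++ r)
  ...   | b' , r' , e' = b' , r ++ r' , (begin
    eval (ℋ s) (P ◁ Q ▷ R) (after l)           ≡⟨ eval-◁▷ (ℋ s) P Q R (after l) ⟩
    branch (ℋ s) P R (eval (ℋ s) Q (after l))  ≡⟨ ≡.cong (branch (ℋ s) P R) e ⟩
    branch (ℋ s) P R (b , after (l ++ r))      ≡⟨ e' ⟩
    b' , after ((l ++ r) ++ r')                ≡⟨ ≡.cong (λ m → b' , after m) (++-assoc l r r') ⟩
    b' , after (l ++ r ++ r')                  ∎)

  branch-appends s P R true l = eval-appends s P l
  branch-appends s P R false l = eval-appends s R l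

  AgreeBeyond : List A → Oracle → Oracle → Set
  AgreeBeyond l s s' = ∀ r a → s (l ++ r) a ≡ s' (l ++ r) a

  agreeBeyond-++ : ∀ {l s s'} r → AgreeBeyond l s s' → AgreeBeyond (l ++ r) s s'
  agreeBeyond-++ {l} {s} {s'} r agree r' a =
    ≡.subst (λ m → s m a ≡ s' m a) (≡.sym (++-assoc l r r')) (agree (r ++ r') a)

  eval-local : ∀ {s s'} X l → AgreeBeyond l s s' → eval (ℋ s) X (after l) ≡ eval (ℋ s') X (after l)
  branch-local : ∀ {s s'} P R b l → AgreeBeyond l s s' →
                 branch (ℋ s) P R (b , after l) ≡ branch (ℋ s') P R (b , after l)

  eval-local (var ())
  eval-local T l agree = ≡.refl
  eval-local F l agree = ≡.refl
  eval-local {s} {s'} (atom a) l agree =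
    ≡.cong (λ b → b , after (l ++ [ a ])) (≡.subst (λ m → s m a ≡ s' m a) (++-identityʳ l) (agree [] a))
  eval-local {s} {s'} (P ◁ Q ▷ R) l agree with eval-appends s Q l
  ... | b , r , e = begin
    eval (ℋ s) (P ◁ Q ▷ R) (after l)             ≡⟨ eval-◁▷ (ℋ s) P Q R (after l) ⟩
    branch (ℋ s) P R (eval (ℋ s) Q (after l))    ≡⟨ ≡.cong (branch (ℋ s) P R) e ⟩
    branch (ℋ s) P R (b , after (l ++ r))
      ≡⟨ branch-local P R b (l ++ r) (agreeBeyond-++ {l} {s} {s'} r agree) ⟩
    branch (ℋ s') P R (b , after (l ++ r))
      ≡⟨ ≡.cong (branch (ℋ s') P R) (≡.trans (≡.sym e) (eval-local Q l agree)) ⟩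
    branch (ℋ s') P R (eval (ℋ s') Q (after l))  ≡⟨ eval-◁▷ (ℋ s') P Q R (after l) ⟨
    eval (ℋ s') (P ◁ Q ▷ R) (after l)            ∎

  branch-local P R true l agree = eval-local P l agree
  branch-local P R false l agree = eval-local R l agree

  observe-local : ∀ {s s'} c X l → AgreeBeyond l s s' →
                  observe (ℋ s) c X (after l) ≡ observe (ℋ s') c X (after l)
  observe-local c X l agree =
    ≡.cong₂ _,_ (≡.cong proj₁ (eval-local X l agree)) (≡.cong proj₁ (eval-local (probe c X) l agree))

  eval-node : ∀ s a X Y l → eval (ℋ s) (X ◁ atom a ▷ Y) (after l) ≡
                            eval (ℋ s) (if s l a then X else Y) (after (l ++ [ a ]))
  eval-node s a X Y l =
    ≡.trans (eval-◁▷ (ℋ s) X (atom a) Y (after l)) (branch-if (ℋ s) X Y (s l a) (after (l ++ [ a ])))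

  probe-node : ∀ s c a X Y l → ∃ λ r →
               proj₂ (observe (ℋ s) c (X ◁ atom a ▷ Y) (after l)) ≡ s ((l ++ [ a ]) ++ r) c
  probe-node s c a X Y l with eval-appends s (if s l a then X else Y) (l ++ [ a ])
  ... | b , r , e = r , ≡.cong proj₂ (begin
    observe (ℋ s) c (X ◁ atom a ▷ Y) (after l)
      ≡⟨ observe-eval (ℋ s) c (X ◁ atom a ▷ Y) (after l) ⟩
    readout (ℋ s) c (eval (ℋ s) (X ◁ atom a ▷ Y) (after l))
      ≡⟨ ≡.cong (readout (ℋ s) c) (≡.trans (eval-node s a X Y l) e) ⟩
    readout (ℋ s) c (b , after ((l ++ [ a ]) ++ r))  ∎)

  entryAt : ℕ → List A → Maybe A
  entryAt _ [] = nothing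
  entryAt zero (b ∷ _) = just b
  entryAt (suc k) (_ ∷ m) = entryAt k m

  entryAt-length : ∀ l → entryAt (length l) l ≡ nothing
  entryAt-length [] = ≡.refl
  entryAt-length (_ ∷ l) = entryAt-length l

  entryAt-length-++ : ∀ l b r → entryAt (length l) ((l ++ [ b ]) ++ r) ≡ just b
  entryAt-length-++ [] b r = ≡.refl
  entryAt-length-++ (_ ∷ l) b r = entryAt-length-++ l b r

  -- On a history extending l, replies true exactly when the first atom queried after l was a.
  queriedFirst : A → List A → Oracle
  queriedFirst a l m _ = maybe′ (does ∘ (a ≟_)) false (entryAt (length l) m)

  queriedFirst-here : ∀ a l c → queriedFirst a l l c ≡ false
  queriedFirst-here a l c = ≡.cong (maybe′ (does ∘ (a ≟_)) false) (entryAt-length l)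

  probe-node-queriedFirst : ∀ c a b X Y l →
    proj₂ (observe (ℋ (queriedFirst a l)) c (X ◁ atom b ▷ Y) (after l)) ≡ does (a ≟ b)
  probe-node-queriedFirst c a b X Y l =
    let (r , e) = probe-node (queriedFirst a l) c b X Y l
    in ≡.trans e (≡.cong (maybe′ (does ∘ (a ≟_)) false) (entryAt-length-++ l b r))

  -- Every history no longer than l is redirected, but a run from l never revisits those.
  _[_↦_] : Oracle → List A → Bool → Oracle
  (s [ l ↦ v ]) m a = maybe′ (λ _ → s m a) v (entryAt (length l) m)

  ↦-here : ∀ s l v a → (s [ l ↦ v ]) l a ≡ v
  ↦-here s l v a = ≡.cong (maybe′ (λ _ → s l a) v) (entryAt-length l)

  ↦-agreeBeyond : ∀ s l v b → AgreeBeyond (l ++ [ b ]) (s [ l ↦ v ]) s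
  ↦-agreeBeyond s l v b r a =
    ≡.cong (maybe′ (λ _ → s ((l ++ [ b ]) ++ r) a) v) (entryAt-length-++ l b r)

  observe-↦ : ∀ s v c a X Y l →
    observe (ℋ (s [ l ↦ v ])) c (X ◁ atom a ▷ Y) (after l) ≡
    observe (ℋ s) c (if v then X else Y) (after (l ++ [ a ]))
  observe-↦ s v c a X Y l =
    ≡.trans (eval≡⇒observe≡ (ℋ s') c (X ◁ atom a ▷ Y) (after l) B (after (l ++ [ a ])) eval-↦)
            (observe-local c B (l ++ [ a ]) (↦-agreeBeyond s l v a))
    where
    s' = s [ l ↦ v ]
    B = if v then X else Y

    eval-↦ : eval (ℋ s') (X ◁ atom a ▷ Y) (after l) ≡ eval (ℋ s') B (after (l ++ [ a ]))
    eval-↦ = ≡.trans (eval-node s' a X Y l)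
      (≡.cong (λ b → eval (ℋ s') (if b then X else Y) (after (l ++ [ a ]))) (↦-here s l v a))

  record Distinguishable (X Y : Closed A) (l : List A) : Set where
    constructor distinguishedBy
    field
      oracle : Oracle
      probeAtom : A
      differ : observe (ℋ oracle) probeAtom X (after l) ≢ observe (ℋ oracle) probeAtom Y (after l)

  distinguishable-sym : ∀ {X Y l} → Distinguishable X Y l → Distinguishable Y X l
  distinguishable-sym (distinguishedBy s c differ) = distinguishedBy s c (differ ∘ ≡.sym)

  distinguish-first-query : ∀ L a X Y l c →
    proj₂ (observe (ℋ (queriedFirst a l)) c L (after l)) ≡ false →
    Distinguishable L (X ◁ atom a ▷ Y) l
  distinguish-first-query L a X Y l c L-false =
    distinguishedBy s c λ same → true≢false (begin
      true                                                 ≡⟨ dec-true (a ≟ a) ≡.refl ⟨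
      does (a ≟ a)                                         ≡⟨ probe-node-queriedFirst c a a X Y l ⟨
      proj₂ (observe (ℋ s) c (X ◁ atom a ▷ Y) (after l))  ≡⟨ ≡.cong proj₂ same ⟨
      proj₂ (observe (ℋ s) c L (after l))                  ≡⟨ L-false ⟩
      false                                                ∎)
    where
    s = queriedFirst a l

  distinguish-after-query : ∀ v a X Y X' Y' l →
    Distinguishable (if v then X else Y) (if v then X' else Y') (l ++ [ a ]) →
    Distinguishable (X ◁ atom a ▷ Y) (X' ◁ atom a ▷ Y') l
  distinguish-after-query v a X Y X' Y' l (distinguishedBy s c differ) =
    distinguishedBy (s [ l ↦ v ]) c λ same →
    differ (≡.trans (≡.sym (observe-↦ s v c a X Y l)) (≡.trans same (observe-↦ s v c a X' Y' l)))

  separate : A → ∀ {X Y} → IsBasic X → IsBasic Y → ∀ l → X ≡ Y ⊎ Distinguishable X Y l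
  separate c leafT leafT l = inj₁ ≡.refl
  separate c leafF leafF l = inj₁ ≡.refl
  separate c leafT leafF l = inj₂ (distinguishedBy (λ _ _ → true) c (true≢false ∘ ≡.cong proj₁))
  separate c leafF leafT l =
    inj₂ (distinguishedBy (λ _ _ → true) c (true≢false ∘ ≡.cong proj₁ ∘ ≡.sym))
  separate c leafT (node a _ _) l = inj₂ (distinguish-first-query T a _ _ l c (queriedFirst-here a l c))
  separate c leafF (node a _ _) l = inj₂ (distinguish-first-query F a _ _ l c (queriedFirst-here a l c))
  separate c (node a _ _) leafT l =
    inj₂ (distinguishable-sym (distinguish-first-query T a _ _ l c (queriedFirst-here a l c)))
  separate c (node a _ _) leafF l =
    inj₂ (distinguishable-sym (distinguish-first-query F a _ _ l c (queriedFirst-here a l c)))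
  separate c (node a x y) (node b x' y') l with a ≟ b
  ... | no a≢b = inj₂ (distinguish-first-query _ b _ _ l c
          (≡.trans (probe-node-queriedFirst c b a _ _ l) (dec-false (b ≟ a) (a≢b ∘ ≡.sym))))
  ... | yes ≡.refl with separate c x x' (l ++ [ a ])
  ...   | inj₂ differ = inj₂ (distinguish-after-query true a _ _ _ _ l differ)
  ...   | inj₁ ≡.refl with separate c y y' (l ++ [ a ])
  ...     | inj₂ differ = inj₂ (distinguish-after-query false a _ _ _ _ l differ)
  ...     | inj₁ ≡.refl = inj₁ ≡.refl

  =fr⇒basic-indistinguishable : ∀ {P Q} → P =fr Q → ∀ l → ¬ Distinguishable (basic P) (basic Q) l
  =fr⇒basic-indistinguishable {P} {Q} P=Q l (distinguishedBy s c differ) = differ (begin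
    observe (ℋ s) c (basic P) (after l)  ≡⟨ observe-basic (ℋ s) c P (after l) ⟩
    observe (ℋ s) c P (after l)          ≡⟨ =fr⇒observe≡ P=Q (ℋ s) c (after l) ⟩
    observe (ℋ s) c Q (after l)          ≡⟨ observe-basic (ℋ s) c Q (after l) ⟨
    observe (ℋ s) c (basic Q) (after l)  ∎)

mainTheorem4 : (n : ℕ) (P Q : Closed (Fin (suc n))) →
    P =fr Q → CP⊢ embed P ≐ embed Q
mainTheorem4 n P Q P=Q
  with History.separate Fin._≟_ Fin.zero (basic-isBasic P) (basic-isBasic Q) []
... | inj₁ same = basic≡⇒CP⊢ P Q same
... | inj₂ differ = ⊥-elim (History.=fr⇒basic-indistinguishable Fin._≟_ P=Q [] differ)
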